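{- Let $G$ be an undirected graph with non-negative real edge weights, $s\in V(G)$, and $T$ a shortest-path tree of $G$ rooted at $s$. Let $e=(u,v)\in E(T)$, where $u$ is the parent of $v$ in $T$, and let $t\in V(T_v)$. Let $P_e(t)=\pi_{G-e}(s,v)\circ\pi_T(v,t)$, so that $w(P_e(t))=d_{G-e}(s,v)+d_G(v,t)$. Then at least one of the following holds: (i) $d_{G-e}(s,t)\le w(P_e(t))\le 2\,d_{G-e}(s,t)$; (ii) $d_{G-e}(s,t)<2\,d_G(s,t)$.
   Context: $d_H(x,y)$ is the shortest-path distance in $H$, $\pi_H(x,y)$ a shortest path from $x$ to $y$ in $H$, $G-e$ is $G$ with edge $e$ removed, $\circ$ is path concatenation, and $w(P)$ is the total weight of a path $P$. $T_v$ is the subtree of $T$ rooted at $v$ and $\pi_T(v,t)$ is the tree path from $v$ to $t$ (a shortest path in $G$). Assume $G-e$ is connected.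
   Formalization: The edge weights of G are non-negative rationals instead of non-negative reals. -}

module Defs where

open import Data.Nat using (ℕ)
open import Data.Fin using (Fin)
open import Data.Product using (_×_; _,_; Σ)
open import Data.Sum using (_⊎_)
open import Data.Unit using (⊤; tt)
open import Data.Rational using (ℚ; 0ℚ; 1ℚ; _+_; _*_; _≤_; _<_)
open import Relation.Binary.PropositionalEquality using (_≡_; _≢_)

-- An undirected (multi)graph on vertex set Fin n with m edges;
-- edge i has (unordered) endpoints ends i and weight wt i (non-negative, checked separately).
record Graph (n m : ℕ) : Set where
  field
    ends : Fin m → Fin n × Fin n
    wt   : Fin m → ℚ
open Graph public

NonNegWeights : ∀ {n m} → Graph n m → Set
NonNegWeights G = ∀ i → 0ℚ ≤ wt G i

Joins : ∀ {n m} → Graph n m → Fin m → Fin n → Fin n → Set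
Joins G i x y = (ends G i ≡ (x , y)) ⊎ (ends G i ≡ (y , x))

-- Walks from x to y using only edges satisfying the predicate 'allowed'
-- (allowed = all edges gives walks in G; allowed i = i ≢ e gives walks in G - e).
data Walk {n m} (G : Graph n m) (allowed : Fin m → Set) : Fin n → Fin n → Set where
  []   : ∀ {x} → Walk G allowed x x
  step : ∀ {x z y} (i : Fin m) → allowed i → Joins G i x z →
         Walk G allowed z y → Walk G allowed x y

weight : ∀ {n m} {G : Graph n m} {A : Fin m → Set} {x y} → Walk G A x y → ℚ
weight []                      = 0ℚ
weight {G = G} (step i _ _ W)  = wt G i + weight W

AllEdges : ∀ {m} → Fin m → Set
AllEdges _ = ⊤

Without : ∀ {m} → Fin m → Fin m → Set
Without e i = i ≢ e

IsDist : ∀ {n m} (G : Graph n m) (allowed : Fin m → Set) → Fin n → Fin n → ℚ → Set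
IsDist G A x y d =
  Σ (Walk G A x y) (λ W → weight W ≡ d) × (∀ (W : Walk G A x y) → d ≤ weight W)

-- A rooted spanning tree of G, given by a parent map and parent edges.
-- 'Anc s par a x' means a is an ancestor of x (x ∈ T_a),
-- obtained by following parent pointers from x (never stepping past the root s).
data Anc {n} (s : Fin n) (par : Fin n → Fin n) (a : Fin n) : Fin n → Set where
  here  : Anc s par a a
  there : ∀ {x} → x ≢ s → Anc s par a (par x) → Anc s par a x

record RootedTree {n m} (G : Graph n m) (s : Fin n) : Set where
  field
    par      : Fin n → Fin n          -- parent in T (value at s irrelevant)
    pedge    : Fin n → Fin m
    pjoins   : ∀ x → x ≢ s → Joins G (pedge x) (par x) x
    spanning : ∀ x → Anc s par s x
open RootedTree public

snoc : ∀ {n m} {G : Graph n m} {p q x} → Walk G AllEdges p q → (i : Fin m) →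
       Joins G i q x → Walk G AllEdges p x
snoc [] i j = step i tt j []
snoc (step k ok j W) i j' = step k ok j (snoc W i j')

treePath : ∀ {n m} {G : Graph n m} {s} (T : RootedTree G s) {a x} →
           Anc s (par T) a x → Walk G AllEdges a x
treePath T here = []
treePath T (there {x} x≢s anc) = snoc (treePath T anc) (pedge T x) (pjoins T x x≢s)

IsShortestPathTree : ∀ {n m} {G : Graph n m} {s} → RootedTree G s → Set
IsShortestPathTree {G = G} {s} T =
  ∀ x (anc : Anc s (par T) s x) (W : Walk G AllEdges s x) →
  weight (treePath T anc) ≤ weight W

two : ℚ
two = 1ℚ + 1ℚ

{-# OPTIONS --safe #-}
-- Write e for the parent edge of v, A = d_{G-e}(s,v), B = d_G(v,t), D = d_{G-e}(s,t) and
-- d = d_G(s,t).  The tree path π_T(v,t) stays inside T_v, so it avoids e; and as a subpath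
-- of a shortest path it is itself shortest, so it has weight B ≤ d.  Going forwards or
-- backwards along it in G - e gives D ≤ A + B and A ≤ D + B.  Hence A + B ≤ D + 2d, which
-- is at most 2D unless D < 2d.
module Submission where

open import Defs
open import Data.Fin using (Fin)
open import Data.Product using (_×_; _,_; proj₁; proj₂)
open import Data.Sum using (_⊎_; inj₁; inj₂)
open import Data.Unit using (tt)
open import Data.Empty using (⊥)
open import Data.Rational using (ℚ; 0ℚ; 1ℚ; -_; _+_; _*_; _≤_; _<_)
open import Data.Rational.Properties
open import Relation.Nullary using (¬_; yes; no)
open import Relation.Binary.PropositionalEquality

module _ {n m} {G : Graph n m} where

  infixr 5 _++_
  _++_ : ∀ {A x y z} → Walk G A x y → Walk G A y z → Walk G A x z
  []           ++ W′ = W′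
  step i a j W ++ W′ = step i a j (W ++ W′)

  weight-++ : ∀ {A x y z} (W : Walk G A x y) (W′ : Walk G A y z) →
              weight (W ++ W′) ≡ weight W + weight W′
  weight-++ []             W′ = sym (+-identityˡ _)
  weight-++ (step i a j W) W′ =
    trans (cong (wt G i +_) (weight-++ W W′)) (sym (+-assoc (wt G i) _ _))

  joins-sym : ∀ {i x y} → Joins G i x y → Joins G i y x
  joins-sym (inj₁ eq) = inj₂ eq
  joins-sym (inj₂ eq) = inj₁ eq

  joins-coincide : ∀ {i a b c d} → Joins G i a b → Joins G i c d → b ≡ d ⊎ b ≡ c
  joins-coincide (inj₁ p) (inj₁ q) = inj₁ (cong proj₂ (trans (sym p) q))
  joins-coincide (inj₁ p) (inj₂ q) = inj₂ (cong proj₂ (trans (sym p) q))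
  joins-coincide (inj₂ p) (inj₁ q) = inj₂ (cong proj₁ (trans (sym p) q))
  joins-coincide (inj₂ p) (inj₂ q) = inj₁ (cong proj₁ (trans (sym p) q))

  reverse : ∀ {A x y} → Walk G A x y → Walk G A y x
  reverse []             = []
  reverse (step i a j W) = reverse W ++ step i a (joins-sym j) []

  weight-reverse : ∀ {A x y} (W : Walk G A x y) → weight (reverse W) ≡ weight W
  weight-reverse []             = refl
  weight-reverse (step i a j W) = begin
    weight (reverse W ++ step i a (joins-sym j) []) ≡⟨ weight-++ (reverse W) _ ⟩
    weight (reverse W) + (wt G i + 0ℚ)  ≡⟨ cong₂ _+_ (weight-reverse W) (+-identityʳ _) ⟩
    weight W + wt G i                   ≡⟨ +-comm (weight W) (wt G i) ⟩
    wt G i + weight W                   ∎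
    where open ≡-Reasoning

  snoc≡++ : ∀ {x y z} (W : Walk G AllEdges x y) i (j : Joins G i y z) →
            snoc W i j ≡ W ++ step i tt j []
  snoc≡++ []              i j = refl
  snoc≡++ (step k a j′ W) i j = cong (step k a j′) (snoc≡++ W i j)

  weight-snoc : ∀ {x y z} (W : Walk G AllEdges x y) i (j : Joins G i y z) →
                weight (snoc W i j) ≡ weight W + wt G i
  weight-snoc W i j = begin
    weight (snoc W i j)             ≡⟨ cong weight (snoc≡++ W i j) ⟩
    weight (W ++ step i tt j [])    ≡⟨ weight-++ W _ ⟩
    weight W + (wt G i + 0ℚ)        ≡⟨ cong (weight W +_) (+-identityʳ (wt G i)) ⟩
    weight W + wt G i               ∎
    where open ≡-Reasoning

  weight-nonneg : ∀ {A x y} → NonNegWeights G → (W : Walk G A x y) → 0ℚ ≤ weight W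
  weight-nonneg nn []             = ≤-refl
  weight-nonneg nn (step i a j W) = +-mono-≤ (nn i) (weight-nonneg nn W)

  IsDist-unique : ∀ {A x y d d′} → IsDist G A x y d → IsDist G A x y d′ → d ≡ d′
  IsDist-unique ((W , refl) , d-min) ((W′ , refl) , d′-min) = ≤-antisym (d-min W′) (d′-min W)

  IsDist-≤-+ : ∀ {A x y z d d′} → IsDist G A x z d → IsDist G A x y d′ →
               (W : Walk G A y z) → d ≤ d′ + weight W
  IsDist-≤-+ (_ , d-min) ((W′ , refl) , _) W =
    ≤-trans (d-min (W′ ++ W)) (≤-reflexive (weight-++ W′ W))

+-cancelˡ-≤ : ∀ p {q r} → p + q ≤ p + r → q ≤ r
+-cancelˡ-≤ p {q} {r} p+q≤p+r = begin
  q             ≡⟨ sym (-p+[p+x]≡x q) ⟩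
  - p + (p + q) ≤⟨ +-monoʳ-≤ (- p) p+q≤p+r ⟩
  - p + (p + r) ≡⟨ -p+[p+x]≡x r ⟩
  r             ∎
  where
  open ≤-Reasoning
  -p+[p+x]≡x : ∀ x → - p + (p + x) ≡ x
  -p+[p+x]≡x x =
    trans (sym (+-assoc (- p) p x)) (trans (cong (_+ x) (+-inverseˡ p)) (+-identityˡ x))

two*p≡p+p : ∀ p → two * p ≡ p + p
two*p≡p+p p = trans (*-distribʳ-+ p 1ℚ 1ℚ) (cong₂ _+_ (*-identityˡ p) (*-identityˡ p))

+-≤-two* : ∀ {a b c d} → a ≤ c + b → b ≤ d → two * d ≤ c → a + b ≤ two * c
+-≤-two* {a} {b} {c} {d} a≤c+b b≤d 2d≤c = begin
  a + b         ≤⟨ +-monoˡ-≤ b a≤c+b ⟩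
  (c + b) + b   ≡⟨ +-assoc c b b ⟩
  c + (b + b)   ≤⟨ +-monoʳ-≤ c (+-mono-≤ b≤d b≤d) ⟩
  c + (d + d)   ≡⟨ cong (c +_) (sym (two*p≡p+p d)) ⟩
  c + two * d   ≤⟨ +-monoʳ-≤ c 2d≤c ⟩
  c + c         ≡⟨ sym (two*p≡p+p c) ⟩
  two * c       ∎
  where open ≤-Reasoning

module _ {n} {s : Fin n} {par : Fin n → Fin n} where

  Anc-trans : ∀ {a b c} → Anc s par a b → Anc s par b c → Anc s par a c
  Anc-trans a↝b here             = a↝b
  Anc-trans a↝b (there c≢s a↝pc) = there c≢s (Anc-trans a↝b a↝pc)

  ¬Anc-parent : ∀ {v} → v ≢ s → Anc s par s v → ¬ Anc s par v (par v)
  ¬Anc-parent {v} v≢s s↝v v↝pv = reach-both s↝v here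
    where
    -- following parents from v loops back to v, so the walk up from y can never reach s
    reach-both : ∀ {y} → Anc s par s y → Anc s par v y → ⊥
    reach-both here           here           = v≢s refl
    reach-both here           (there s≢s _)  = s≢s refl
    reach-both (there _ s↝pv) here           = reach-both s↝pv v↝pv
    reach-both (there _ s↝py) (there _ v↝py) = reach-both s↝py v↝py

module _ {n m} {G : Graph n m} {s : Fin n} (T : RootedTree G s) where

  treeWeight : ∀ {a x} → Anc s (par T) a x → ℚ
  treeWeight a↝x = weight (treePath T a↝x)

  treeWeight-trans : ∀ {a b c} (a↝b : Anc s (par T) a b) (b↝c : Anc s (par T) b c) →
                     treeWeight (Anc-trans a↝b b↝c) ≡ treeWeight a↝b + treeWeight b↝c
  treeWeight-trans a↝b here                 = sym (+-identityʳ _)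
  treeWeight-trans a↝b (there {c} c≢s b↝pc) = begin
    treeWeight (there c≢s a↝pc)       ≡⟨ weight-snoc (treePath T a↝pc) e j ⟩
    treeWeight a↝pc + wt G e          ≡⟨ cong (_+ wt G e) (treeWeight-trans a↝b b↝pc) ⟩
    (wab + treeWeight b↝pc) + wt G e  ≡⟨ +-assoc wab _ _ ⟩
    wab + (treeWeight b↝pc + wt G e)  ≡⟨ cong (wab +_) (sym (weight-snoc (treePath T b↝pc) e j)) ⟩
    wab + treeWeight (there c≢s b↝pc) ∎
    where
    open ≡-Reasoning
    a↝pc = Anc-trans a↝b b↝pc
    e = pedge T c
    j = pjoins T c c≢s
    wab = treeWeight a↝b

  treeWeight-suffix : NonNegWeights G →
                      ∀ {a b c} (a↝b : Anc s (par T) a b) (b↝c : Anc s (par T) b c) →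
                      treeWeight b↝c ≤ treeWeight (Anc-trans a↝b b↝c)
  treeWeight-suffix nn a↝b b↝c = begin
    treeWeight b↝c                  ≡⟨ sym (+-identityˡ _) ⟩
    0ℚ + treeWeight b↝c             ≤⟨ +-monoˡ-≤ _ (weight-nonneg nn (treePath T a↝b)) ⟩
    treeWeight a↝b + treeWeight b↝c ≡⟨ sym (treeWeight-trans a↝b b↝c) ⟩
    treeWeight (Anc-trans a↝b b↝c)  ∎
    where open ≤-Reasoning

  pedge-below-≢ : ∀ {v x} → v ≢ s → x ≢ s → Anc s (par T) v (par T x) →
                  pedge T x ≢ pedge T v
  pedge-below-≢ {v} {x} v≢s x≢s v↝px same = ¬Anc-parent v≢s (spanning T v) v↝pv
    where
    x-joins : Joins G (pedge T v) (par T x) x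
    x-joins = subst (λ i → Joins G i (par T x) x) same (pjoins T x x≢s)
    v↝pv : Anc s (par T) v (par T v)
    v↝pv with joins-coincide {G = G} x-joins (pjoins T v v≢s)
    ... | inj₁ x≡v  = subst (λ y → Anc s (par T) v (par T y)) x≡v v↝px
    ... | inj₂ x≡pv = subst (Anc s (par T) v) x≡pv (there x≢s v↝px)

  treePathAvoiding : ∀ {v x} → v ≢ s → Anc s (par T) v x → Walk G (Without (pedge T v)) v x
  treePathAvoiding v≢s here                 = []
  treePathAvoiding v≢s (there {x} x≢s v↝px) =
    treePathAvoiding v≢s v↝px
      ++ step (pedge T x) (pedge-below-≢ v≢s x≢s v↝px) (pjoins T x x≢s) []

  weight-treePathAvoiding : ∀ {v x} (v≢s : v ≢ s) (v↝x : Anc s (par T) v x) →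
                            weight (treePathAvoiding v≢s v↝x) ≡ treeWeight v↝x
  weight-treePathAvoiding v≢s here                 = refl
  weight-treePathAvoiding v≢s (there {x} x≢s v↝px) = begin
    weight (P ++ step e _ j [])  ≡⟨ weight-++ P _ ⟩
    weight P + (wt G e + 0ℚ)     ≡⟨ cong₂ _+_ (weight-treePathAvoiding v≢s v↝px) (+-identityʳ _) ⟩
    treeWeight v↝px + wt G e     ≡⟨ sym (weight-snoc (treePath T v↝px) e j) ⟩
    treeWeight (there x≢s v↝px)  ∎
    where
    open ≡-Reasoning
    P = treePathAvoiding v≢s v↝px
    e = pedge T x
    j = pjoins T x x≢s

  treeWeight-isDist : IsShortestPathTree T →
                      ∀ {a x} (a↝x : Anc s (par T) a x) → IsDist G AllEdges a x (treeWeight a↝x)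
  treeWeight-isDist spt {a} a↝x = (treePath T a↝x , refl) , shortest
    where
    s↝a = spanning T a
    s↝x = Anc-trans s↝a a↝x
    shortest : ∀ W → treeWeight a↝x ≤ weight W
    shortest W = +-cancelˡ-≤ (treeWeight s↝a) (begin
      treeWeight s↝a + treeWeight a↝x  ≡⟨ sym (treeWeight-trans s↝a a↝x) ⟩
      treeWeight s↝x                   ≤⟨ spt _ s↝x (treePath T s↝a ++ W) ⟩
      weight (treePath T s↝a ++ W)     ≡⟨ weight-++ (treePath T s↝a) W ⟩
      treeWeight s↝a + weight W        ∎)
      where open ≤-Reasoning

mainTheorem4 : ∀ {n m} (G : Graph n m) → NonNegWeights G →
    (s : Fin n) (T : RootedTree G s) → IsShortestPathTree T →
    (v : Fin n) → v ≢ s →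
    (t : Fin n) → Anc s (par T) v t →
    (dGe-sv dGe-st dG-vt dG-st : ℚ) →
    IsDist G (Without (pedge T v)) s v dGe-sv →
    IsDist G (Without (pedge T v)) s t dGe-st →
    IsDist G AllEdges v t dG-vt →
    IsDist G AllEdges s t dG-st →
    (dGe-st ≤ dGe-sv + dG-vt × dGe-sv + dG-vt ≤ two * dGe-st)
    ⊎ dGe-st < two * dG-st
mainTheorem4 G nn s T spt v v≢s t v↝t A D B d distA distD distB distd
  with two * d ≤? D
... | no  2d≰D = inj₂ (≰⇒> 2d≰D)
... | yes 2d≤D = inj₁ (D≤A+B , +-≤-two* A≤D+B B≤d 2d≤D)
  where
  s↝t = Anc-trans (spanning T v) v↝t
  P = treePathAvoiding T v≢s v↝t
  B≡wvt : B ≡ treeWeight T v↝t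
  B≡wvt = IsDist-unique distB (treeWeight-isDist T spt v↝t)
  B≡wP : B ≡ weight P
  B≡wP = trans B≡wvt (sym (weight-treePathAvoiding T v≢s v↝t))
  B≤d : B ≤ d
  B≤d = begin
    B                ≡⟨ B≡wvt ⟩
    treeWeight T v↝t ≤⟨ treeWeight-suffix T nn (spanning T v) v↝t ⟩
    treeWeight T s↝t ≡⟨ IsDist-unique (treeWeight-isDist T spt s↝t) distd ⟩
    d                ∎
    where open ≤-Reasoning
  D≤A+B : D ≤ A + B
  D≤A+B = subst (λ b → D ≤ A + b) (sym B≡wP) (IsDist-≤-+ distD distA P)
  A≤D+B : A ≤ D + B
  A≤D+B = subst (λ b → A ≤ D + b) (trans (weight-reverse P) (sym B≡wP))
                (IsDist-≤-+ distA distD (reverse P))
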